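{- There is a $\lambda$-term $\mathtt{pred}$ of $\Lambda_{\tt det}$ such that for every term $k$ and every natural number $n \geq 1$, $$\mathtt{pred}\, k\, \lceil \mathrm{bin}(n)\rceil \rightarrow_{det}^{O(\log n)} k\, \lceil \textsc{pred}(\mathrm{bin}(n))\rceil,$$ where $\textsc{pred}(\mathrm{bin}(n)) = \mathrm{bin}(n-1)$.
   Context: $\Lambda_{\tt det}$: terms $t ::= v \mid t\,v$, values $v ::= \lambda x.t \mid x$; evaluation contexts $E ::= [\cdot] \mid E\,v$; reduction $E[(\lambda x.t)u] \rightarrow_{det} E[t\{x:=u\}]$. For $n\in\mathbb{N}$, $\mathrm{bin}(n)\in\{0,1\}^*$ is the reversed binary representation of $n$ (least significant bit first) with no trailing $0$s; e.g. $\mathrm{bin}(0)=\varepsilon$, $\mathrm{bin}(2)=01$, $\mathrm{bin}(4)=001$. The function $\textsc{pred}$ on such strings is defined by $\textsc{pred}(0s)=1\,\textsc{pred}(s)$, $\textsc{pred}(1\varepsilon)=\varepsilon$, $\textsc{pred}(1bs)=0bs$ for a bit $b$. Binary strings are Scott-encoded: $\lceil\varepsilon\rceil := \lambda x_0.\lambda x_1.\lambda x_\varepsilon.x_\varepsilon$, $\lceil 0 s\rceil := \lambda x_0.\lambda x_1.\lambda x_\varepsilon.x_0\lceil s\rceil$, $\lceil 1 s\rceil := \lambda x_0.\lambda x_1.\lambda x_\varepsilon.x_1\lceil s\rceil$. -}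

module Defs where

open import Data.Nat using (ℕ; zero; suc; _%_; ⌊_/2⌋)
open import Data.Fin using (Fin; zero; suc)
open import Data.List using (List; []; _∷_)

-- Λ_det, well-scoped de Bruijn syntax (Term n: at most n free variables)
--   terms  t ::= v | t v      values v ::= λx.t | x

mutual
  data Term (n : ℕ) : Set where
    val : Val n → Term n
    app : Term n → Val n → Term n

  data Val (n : ℕ) : Set where
    lam : Term (suc n) → Val n
    var : Fin n → Val n

ext : ∀ {n m} → (Fin n → Fin m) → Fin (suc n) → Fin (suc m)
ext ρ zero    = zero
ext ρ (suc i) = suc (ρ i)

mutual
  renT : ∀ {n m} → (Fin n → Fin m) → Term n → Term m
  renT ρ (val v)   = val (renV ρ v)
  renT ρ (app t v) = app (renT ρ t) (renV ρ v)

  renV : ∀ {n m} → (Fin n → Fin m) → Val n → Val m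
  renV ρ (lam t) = lam (renT (ext ρ) t)
  renV ρ (var i) = var (ρ i)

exts : ∀ {n m} → (Fin n → Val m) → Fin (suc n) → Val (suc m)
exts σ zero    = var zero
exts σ (suc i) = renV suc (σ i)

mutual
  subT : ∀ {n m} → (Fin n → Val m) → Term n → Term m
  subT σ (val v)   = val (subV σ v)
  subT σ (app t v) = app (subT σ t) (subV σ v)

  subV : ∀ {n m} → (Fin n → Val m) → Val n → Val m
  subV σ (lam t) = lam (subT (exts σ) t)
  subV σ (var i) = σ i

-- t{x:=u}, x being the outermost bound variable (index 0)
single : ∀ {n} → Val n → Fin (suc n) → Val n
single u zero    = u
single u (suc i) = var i

_[_] : ∀ {n} → Term (suc n) → Val n → Term n
t [ u ] = subT (single u) t

emptyRen : ∀ {n} → Fin 0 → Fin n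
emptyRen ()

weaken : ∀ {n} → Term 0 → Term n
weaken = renT emptyRen

-- Deterministic reduction  E[(λx.t)u] →det E[t{x:=u}],  E ::= [·] | E v

data _⟶_ {n : ℕ} : Term n → Term n → Set where
  β   : ∀ (t : Term (suc n)) (u : Val n) → app (val (lam t)) u ⟶ (t [ u ])
  ctx : ∀ {t t′ : Term n} (v : Val n) → t ⟶ t′ → app t v ⟶ app t′ v

data _⟶[_]_ {n : ℕ} : Term n → ℕ → Term n → Set where
  done : ∀ {t} → t ⟶[ zero ] t
  step : ∀ {t t′ t″ m} → t ⟶ t′ → t′ ⟶[ m ] t″ → t ⟶[ suc m ] t″

data Bit : Set where
  b0 b1 : Bit

-- reversed binary representation (LSB first, no trailing 0s);
-- fuel argument is n itself, which suffices
binAux : ℕ → ℕ → List Bit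
binAux zero    _       = []
binAux (suc f) zero    = []
binAux (suc f) (suc k) with (suc k) % 2
... | zero  = b0 ∷ binAux f ⌊ suc k /2⌋
... | suc _ = b1 ∷ binAux f ⌊ suc k /2⌋

bin : ℕ → List Bit
bin n = binAux n n

-- PRED(0s) = 1 PRED(s), PRED(1ε) = ε, PRED(1bs) = 0bs ; PRED(ε) unspecified (set to ε)
PRED : List Bit → List Bit
PRED (b0 ∷ s)     = b1 ∷ PRED s
PRED (b1 ∷ [])    = []
PRED (b1 ∷ b ∷ s) = b0 ∷ b ∷ s
PRED []           = []

-- Scott encoding  ⌈ε⌉ = λx0.λx1.λxε.xε, ⌈0s⌉ = λx0.λx1.λxε.x0⌈s⌉, ⌈1s⌉ = λx0.λx1.λxε.x1⌈s⌉
⌈_⌉ : ∀ {n} → List Bit → Val n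
⌈ [] ⌉     = lam (val (lam (val (lam (val (var zero))))))
⌈ b0 ∷ s ⌉ = lam (val (lam (val (lam (app (val (var (suc (suc zero)))) ⌈ s ⌉)))))
⌈ b1 ∷ s ⌉ = lam (val (lam (val (lam (app (val (var (suc zero))) ⌈ s ⌉)))))

module Submission where

-- pred is a loop obtained by self-application that scans the Scott-encoded string: every
-- leading 0 is consumed while a 1 is pushed onto the continuation, and the first 1 is
-- turned into a 0 (or dropped when it is the last bit).  Each bit costs a constant number
-- of β-steps, so a run costs O(#leading zeros of bin n) ≤ O(⌊log₂ n⌋).  Correctness of
-- PRED follows from bin (2m+1) = 1 bin m and bin (2m+2) = 0 bin (m+1) by induction along
-- this binary view of n.

open import Defs
open import Data.Nat using (ℕ; zero; suc; _+_; _*_; _∸_; _≤_; _≥_; z≤n; s≤s; _%_; ⌊_/2⌋)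
open import Data.Nat.Properties
  using (≤-refl; ≤-trans; ≤-pred; ⌊n/2⌋<n; m≤n+m; +-comm; +-assoc; *-suc; +-monoʳ-≤; +-monoˡ-≤; *-monoʳ-≤; module ≤-Reasoning)
open import Data.Nat.Logarithm using (⌊log₂_⌋; ⌊log₂[2*b]⌋≡1+⌊log₂b⌋)
open import Data.Fin using (Fin; zero; suc; #_)
open import Data.List using (List; []; _∷_)
open import Data.Product using (Σ; ∃; _×_; _,_)
open import Function using (_∘_)
open import Relation.Binary.PropositionalEquality using (_≡_; refl; cong; cong₂; trans; sym; module ≡-Reasoning)

private variable n m p : ℕ

ext-∘ : {ρ : Fin m → Fin p} {ρ′ : Fin n → Fin m} {ρ″ : Fin n → Fin p} →
        (∀ i → ρ (ρ′ i) ≡ ρ″ i) → ∀ i → ext ρ (ext ρ′ i) ≡ ext ρ″ i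
ext-∘ h zero    = refl
ext-∘ h (suc i) = cong suc (h i)

mutual
  renT-renT : {ρ : Fin m → Fin p} {ρ′ : Fin n → Fin m} {ρ″ : Fin n → Fin p} →
              (∀ i → ρ (ρ′ i) ≡ ρ″ i) → ∀ t → renT ρ (renT ρ′ t) ≡ renT ρ″ t
  renT-renT h (val v)   = cong val (renV-renV h v)
  renT-renT h (app t v) = cong₂ app (renT-renT h t) (renV-renV h v)

  renV-renV : {ρ : Fin m → Fin p} {ρ′ : Fin n → Fin m} {ρ″ : Fin n → Fin p} →
              (∀ i → ρ (ρ′ i) ≡ ρ″ i) → ∀ v → renV ρ (renV ρ′ v) ≡ renV ρ″ v
  renV-renV h (lam t) = cong lam (renT-renT (ext-∘ h) t)
  renV-renV h (var i) = cong var (h i)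

exts-ext : {σ : Fin m → Val p} {ρ : Fin n → Fin m} {τ : Fin n → Val p} →
           (∀ i → σ (ρ i) ≡ τ i) → ∀ i → exts σ (ext ρ i) ≡ exts τ i
exts-ext h zero    = refl
exts-ext h (suc i) = cong (renV suc) (h i)

mutual
  subT-renT : {σ : Fin m → Val p} {ρ : Fin n → Fin m} {τ : Fin n → Val p} →
              (∀ i → σ (ρ i) ≡ τ i) → ∀ t → subT σ (renT ρ t) ≡ subT τ t
  subT-renT h (val v)   = cong val (subV-renV h v)
  subT-renT h (app t v) = cong₂ app (subT-renT h t) (subV-renV h v)

  subV-renV : {σ : Fin m → Val p} {ρ : Fin n → Fin m} {τ : Fin n → Val p} →
              (∀ i → σ (ρ i) ≡ τ i) → ∀ v → subV σ (renV ρ v) ≡ subV τ v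
  subV-renV h (lam t) = cong lam (subT-renT (exts-ext h) t)
  subV-renV h (var i) = h i

ext-exts : {ρ : Fin m → Fin p} {σ : Fin n → Val m} {τ : Fin n → Val p} →
           (∀ i → renV ρ (σ i) ≡ τ i) → ∀ i → renV (ext ρ) (exts σ i) ≡ exts τ i
ext-exts h zero    = refl
ext-exts {ρ = ρ} {σ} {τ} h (suc i) = begin
  renV (ext ρ) (renV suc (σ i)) ≡⟨ renV-renV (λ _ → refl) (σ i) ⟩
  renV (suc ∘ ρ) (σ i)          ≡⟨ sym (renV-renV (λ _ → refl) (σ i)) ⟩
  renV suc (renV ρ (σ i))       ≡⟨ cong (renV suc) (h i) ⟩
  renV suc (τ i)                ∎
  where open ≡-Reasoning

mutual
  renT-subT : {ρ : Fin m → Fin p} {σ : Fin n → Val m} {τ : Fin n → Val p} →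
              (∀ i → renV ρ (σ i) ≡ τ i) → ∀ t → renT ρ (subT σ t) ≡ subT τ t
  renT-subT h (val v)   = cong val (renV-subV h v)
  renT-subT h (app t v) = cong₂ app (renT-subT h t) (renV-subV h v)

  renV-subV : {ρ : Fin m → Fin p} {σ : Fin n → Val m} {τ : Fin n → Val p} →
              (∀ i → renV ρ (σ i) ≡ τ i) → ∀ v → renV ρ (subV σ v) ≡ subV τ v
  renV-subV h (lam t) = cong lam (renT-subT (ext-exts h) t)
  renV-subV h (var i) = h i

subV-exts-renV-suc : (σ : Fin n → Val m) (v : Val n) → subV (exts σ) (renV suc v) ≡ renV suc (subV σ v)
subV-exts-renV-suc σ v =
  trans (subV-renV {τ = renV suc ∘ σ} (λ _ → refl) v) (sym (renV-subV (λ _ → refl) v))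

exts-exts : {σ : Fin m → Val p} {τ : Fin n → Val m} {υ : Fin n → Val p} →
            (∀ i → subV σ (τ i) ≡ υ i) → ∀ i → subV (exts σ) (exts τ i) ≡ exts υ i
exts-exts h zero    = refl
exts-exts {σ = σ} {τ} h (suc i) = trans (subV-exts-renV-suc σ (τ i)) (cong (renV suc) (h i))

mutual
  subT-subT : {σ : Fin m → Val p} {τ : Fin n → Val m} {υ : Fin n → Val p} →
              (∀ i → subV σ (τ i) ≡ υ i) → ∀ t → subT σ (subT τ t) ≡ subT υ t
  subT-subT h (val v)   = cong val (subV-subV h v)
  subT-subT h (app t v) = cong₂ app (subT-subT h t) (subV-subV h v)

  subV-subV : {σ : Fin m → Val p} {τ : Fin n → Val m} {υ : Fin n → Val p} →
              (∀ i → subV σ (τ i) ≡ υ i) → ∀ v → subV σ (subV τ v) ≡ subV υ v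
  subV-subV h (lam t) = cong lam (subT-subT (exts-exts h) t)
  subV-subV h (var i) = h i

exts-var : {σ : Fin n → Val n} → (∀ i → σ i ≡ var i) → ∀ i → exts σ i ≡ var i
exts-var h zero    = refl
exts-var h (suc i) = cong (renV suc) (h i)

mutual
  subT-id : {σ : Fin n → Val n} → (∀ i → σ i ≡ var i) → ∀ t → subT σ t ≡ t
  subT-id h (val v)   = cong val (subV-id h v)
  subT-id h (app t v) = cong₂ app (subT-id h t) (subV-id h v)

  subV-id : {σ : Fin n → Val n} → (∀ i → σ i ≡ var i) → ∀ v → subV σ v ≡ v
  subV-id h (lam t) = cong lam (subT-id (exts-var h) t)
  subV-id h (var i) = h i

subV-single-renV-suc : (u v : Val n) → subV (single u) (renV suc v) ≡ v
subV-single-renV-suc u v = trans (subV-renV {τ = var} (λ _ → refl) v) (subV-id (λ _ → refl) v)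

infixr 5 _•_
_•_ : Val m → (Fin n → Val m) → Fin (suc n) → Val m
(u • σ) zero    = u
(u • σ) (suc i) = σ i

subT-single-exts : (u : Val m) (σ : Fin n → Val m) (t : Term (suc n)) →
                   subT (single u) (subT (exts σ) t) ≡ subT (u • σ) t
subT-single-exts u σ = subT-subT λ { zero → refl ; (suc i) → subV-single-renV-suc u (σ i) }

infixl 25 _·_
_·_ : Term n → Val n → Term n
_·_ = app

infixr 5 _◅◅_
_◅◅_ : {t u w : Term n} {a b : ℕ} → t ⟶[ a ] u → u ⟶[ b ] w → t ⟶[ a + b ] w
done     ◅◅ q = q
step s r ◅◅ q = step s (r ◅◅ q)

ctx* : {t t′ : Term n} {a : ℕ} (v : Val n) → t ⟶[ a ] t′ → t · v ⟶[ a ] t′ · v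
ctx* v done       = done
ctx* v (step s r) = step (ctx v s) (ctx* v r)

⟶[]-respʳ-≡ : {t u u′ : Term n} {a : ℕ} → u ≡ u′ → t ⟶[ a ] u → t ⟶[ a ] u′
⟶[]-respʳ-≡ refl r = r

-- Consecutive β-steps as one simultaneous substitution: on the closed combinators below
-- this computes, so each of their reduction steps holds by definition.
β₂ : (t : Term (2 + n)) (u₁ u₂ : Val n) → val (lam (val (lam t))) · u₁ · u₂ ⟶[ 2 ] subT (u₂ • single u₁) t
β₂ t u₁ u₂ = ⟶[]-respʳ-≡ (subT-single-exts u₂ (single u₁) t) (step (ctx u₂ (β _ u₁)) (step (β _ u₂) done))

β₃ : (t : Term (3 + n)) (u₁ u₂ u₃ : Val n) →
     val (lam (val (lam (val (lam t))))) · u₁ · u₂ · u₃ ⟶[ 3 ] subT (u₃ • u₂ • single u₁) t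
β₃ t u₁ u₂ u₃ = ⟶[]-respʳ-≡ (subT-single-exts u₃ (u₂ • single u₁) t)
  (ctx* u₃ (β₂ (val (lam t)) u₁ u₂) ◅◅ step (β _ u₃) done)

-- ⌈ b ∷ s ⌉ is scottNode b ⌈ s ⌉ by definition.
scottNode : Bit → Val (3 + n) → Val n
scottNode b0 x = lam (val (lam (val (lam (val (var (# 2)) · x)))))
scottNode b1 x = lam (val (lam (val (lam (val (var (# 1)) · x)))))

renV-⌈⌉ : (ρ : Fin n → Fin m) (l : List Bit) → renV ρ ⌈ l ⌉ ≡ ⌈ l ⌉
renV-⌈⌉ ρ []       = refl
renV-⌈⌉ ρ (b0 ∷ s) = cong (scottNode b0) (renV-⌈⌉ _ s)
renV-⌈⌉ ρ (b1 ∷ s) = cong (scottNode b1) (renV-⌈⌉ _ s)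

subV-⌈⌉ : (σ : Fin n → Val m) (l : List Bit) → subV σ ⌈ l ⌉ ≡ ⌈ l ⌉
subV-⌈⌉ σ []       = refl
subV-⌈⌉ σ (b0 ∷ s) = cong (scottNode b0) (subV-⌈⌉ _ s)
subV-⌈⌉ σ (b1 ∷ s) = cong (scottNode b1) (subV-⌈⌉ _ s)

scottCase : List Bit → Val n → Val n → Val n → Term n
scottCase []       z o e = val e
scottCase (b0 ∷ s) z o e = val z · ⌈ s ⌉
scottCase (b1 ∷ s) z o e = val o · ⌈ s ⌉

scott-case : (l : List Bit) (z o e : Val n) → val ⌈ l ⌉ · z · o · e ⟶[ 3 ] scottCase l z o e
scott-case []       z o e = β₃ _ z o e
scott-case (b0 ∷ s) z o e = ⟶[]-respʳ-≡ (cong (val z ·_) (subV-⌈⌉ _ s)) (β₃ _ z o e)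
scott-case (b1 ∷ s) z o e = ⟶[]-respʳ-≡ (cong (val o ·_) (subV-⌈⌉ _ s)) (β₃ _ z o e)

-- ⌈ b ∷ v ⌉ for a value v that need not encode a string.  The three separate shifts are
-- what substitution produces under three binders, so prefix1-step is exact.
scottCons : Bit → Val n → Val n
scottCons b v = scottNode b (renV suc (renV suc (renV suc v)))

renV-suc³-⌈⌉ : (s : List Bit) → renV suc (renV suc (renV suc (⌈_⌉ {n} s))) ≡ ⌈ s ⌉
renV-suc³-⌈⌉ s = begin
  renV suc (renV suc (renV suc ⌈ s ⌉)) ≡⟨ cong (renV suc ∘ renV suc) (renV-⌈⌉ suc s) ⟩
  renV suc (renV suc ⌈ s ⌉)            ≡⟨ cong (renV suc) (renV-⌈⌉ suc s) ⟩
  renV suc ⌈ s ⌉                       ≡⟨ renV-⌈⌉ suc s ⟩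
  ⌈ s ⌉                                ∎
  where open ≡-Reasoning

scottCons-⌈⌉ : (b : Bit) (s : List Bit) → scottCons {n} b ⌈ s ⌉ ≡ ⌈ b ∷ s ⌉
scottCons-⌈⌉ b0 s = cong (scottNode b0) (renV-suc³-⌈⌉ s)
scottCons-⌈⌉ b1 s = cong (scottNode b1) (renV-suc³-⌈⌉ s)

-- In named notation:
--   pred     = λk. λs. predLoop predLoop k s
--   predLoop = λp. λk. λs. s pred0 pred1 predε p k
--   pred0    = λr. λp. λk. p p (prefix1 k) r        prefix1 k = λw. k ⌈1w⌉
--   pred1    = λr. λp. λk. r pred1∷ pred1∷ pred1ε k r
--   predε    = λp. λk. k ⌈ε⌉
--   pred1∷   = λ_. λk. λr. k ⌈0r⌉
--   pred1ε   = λk. λ_. k ⌈ε⌉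

prefix1 : Val n → Val n
prefix1 k = lam (val (renV suc k) · scottCons b1 (var zero))

predε pred1ε pred1∷ pred1 pred0 predLoop : Val n
predε    = lam (val (lam (val (var (# 0)) · ⌈ [] ⌉)))
pred1ε   = lam (val (lam (val (var (# 1)) · ⌈ [] ⌉)))
pred1∷   = lam (val (lam (val (lam (val (var (# 1)) · scottCons b0 (var (# 0)))))))
pred1    = lam (val (lam (val (lam (val (var (# 2)) · pred1∷ · pred1∷ · pred1ε · var (# 0) · var (# 2))))))
pred0    = lam (val (lam (val (lam (val (var (# 1)) · var (# 1) · prefix1 (var (# 0)) · var (# 2))))))
predLoop = lam (val (lam (val (lam (val (var (# 0)) · pred0 · pred1 · predε · var (# 2) · var (# 1))))))

pred : Term 0
pred = val (lam (val (lam (val predLoop · predLoop · var (# 1) · var (# 0)))))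

predLoop-step : (k u : Val n) → val predLoop · predLoop · k · u ⟶[ 3 ] val u · pred0 · pred1 · predε · predLoop · k
predLoop-step k u = β₃ _ predLoop k u

pred0-step : (r p k : Val n) → val pred0 · r · p · k ⟶[ 3 ] val p · p · prefix1 k · r
pred0-step r p k = β₃ _ r p k

pred1-step : (r p k : Val n) → val pred1 · r · p · k ⟶[ 3 ] val r · pred1∷ · pred1∷ · pred1ε · k · r
pred1-step r p k = β₃ _ r p k

predε-step : (p k : Val n) → val predε · p · k ⟶[ 2 ] val k · ⌈ [] ⌉
predε-step p k = β₂ _ p k

pred1ε-step : (k w : Val n) → val pred1ε · k · w ⟶[ 2 ] val k · ⌈ [] ⌉
pred1ε-step k w = β₂ _ k w

pred1∷-step : (w k r : Val n) → val pred1∷ · w · k · r ⟶[ 3 ] val k · scottCons b0 r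
pred1∷-step w k r = β₃ _ w k r

prefix1-step : (k w : Val n) → val (prefix1 k) · w ⟶[ 1 ] val k · scottCons b1 w
prefix1-step k w = ⟶[]-respʳ-≡ (cong (λ x → val x · _) (subV-single-renV-suc w k)) (step (β _ w) done)

pred1-cost : List Bit → ℕ
pred1-cost []      = 5
pred1-cost (_ ∷ _) = 6

predLoop-cost : List Bit → ℕ
predLoop-cost []       = 5
predLoop-cost (b0 ∷ s) = 9 + predLoop-cost s + 1
predLoop-cost (b1 ∷ t) = 6 + pred1-cost t

pred1-run : (k : Val n) (t : List Bit) →
            val ⌈ t ⌉ · pred1∷ · pred1∷ · pred1ε · k · ⌈ t ⌉ ⟶[ pred1-cost t ] val k · ⌈ PRED (b1 ∷ t) ⌉
pred1-run k [] = ctx* ⌈ [] ⌉ (ctx* k (scott-case [] pred1∷ pred1∷ pred1ε)) ◅◅ pred1ε-step k ⌈ [] ⌉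
pred1-run k (b ∷ s) =
  ctx* ⌈ b ∷ s ⌉ (ctx* k (select b)) ◅◅
  ⟶[]-respʳ-≡ (cong (val k ·_) (scottCons-⌈⌉ b0 (b ∷ s))) (pred1∷-step ⌈ s ⌉ k ⌈ b ∷ s ⌉)
  where
  select : ∀ b → val ⌈ b ∷ s ⌉ · pred1∷ · pred1∷ · pred1ε ⟶[ 3 ] val pred1∷ · ⌈ s ⌉
  select b0 = scott-case (b0 ∷ s) pred1∷ pred1∷ pred1ε
  select b1 = scott-case (b1 ∷ s) pred1∷ pred1∷ pred1ε

predLoop-run : (k : Val n) (l : List Bit) →
               val ⌈ l ⌉ · pred0 · pred1 · predε · predLoop · k ⟶[ predLoop-cost l ] val k · ⌈ PRED l ⌉
predLoop-run k [] =
  ctx* k (ctx* predLoop (scott-case [] pred0 pred1 predε)) ◅◅ predε-step predLoop k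
predLoop-run k (b0 ∷ s) =
  ctx* k (ctx* predLoop (scott-case (b0 ∷ s) pred0 pred1 predε)) ◅◅
  pred0-step ⌈ s ⌉ predLoop k ◅◅
  predLoop-step (prefix1 k) ⌈ s ⌉ ◅◅
  predLoop-run (prefix1 k) s ◅◅
  ⟶[]-respʳ-≡ (cong (val k ·_) (scottCons-⌈⌉ b1 (PRED s))) (prefix1-step k ⌈ PRED s ⌉)
predLoop-run k (b1 ∷ t) =
  ctx* k (ctx* predLoop (scott-case (b1 ∷ t) pred0 pred1 predε)) ◅◅
  pred1-step ⌈ t ⌉ predLoop k ◅◅
  pred1-run k t

pred-run : (k : Val n) (l : List Bit) → weaken pred · k · ⌈ l ⌉ ⟶[ 5 + predLoop-cost l ] val k · ⌈ PRED l ⌉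
pred-run k l = β₂ _ k ⌈ l ⌉ ◅◅ predLoop-step k ⌈ l ⌉ ◅◅ predLoop-run k l

leadingZeros : List Bit → ℕ
leadingZeros (b0 ∷ s) = suc (leadingZeros s)
leadingZeros _        = zero

predLoop-cost≤ : ∀ l → predLoop-cost l ≤ 10 * leadingZeros l + 12
predLoop-cost≤ []           = m≤n+m 5 7
predLoop-cost≤ (b0 ∷ s)     = begin
  9 + predLoop-cost s + 1          ≡⟨ +-comm (9 + predLoop-cost s) 1 ⟩
  10 + predLoop-cost s             ≤⟨ +-monoʳ-≤ 10 (predLoop-cost≤ s) ⟩
  10 + (10 * leadingZeros s + 12)  ≡⟨ sym (+-assoc 10 _ 12) ⟩
  10 + 10 * leadingZeros s + 12    ≡⟨ cong (_+ 12) (sym (*-suc 10 (leadingZeros s))) ⟩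
  10 * suc (leadingZeros s) + 12   ∎
  where open ≤-Reasoning
predLoop-cost≤ (b1 ∷ [])    = m≤n+m 11 1
predLoop-cost≤ (b1 ∷ _ ∷ _) = ≤-refl

double : ℕ → ℕ
double zero    = zero
double (suc m) = suc (suc (double m))

double≡2* : ∀ m → double m ≡ 2 * m
double≡2* zero    = refl
double≡2* (suc m) = trans (cong (2 +_) (double≡2* m)) (sym (*-suc 2 m))

double-%2 : ∀ m → double m % 2 ≡ 0
double-%2 zero    = refl
double-%2 (suc m) = double-%2 m

suc-double-%2 : ∀ m → suc (double m) % 2 ≡ 1
suc-double-%2 zero    = refl
suc-double-%2 (suc m) = suc-double-%2 m

⌊double/2⌋ : ∀ m → ⌊ double m /2⌋ ≡ m
⌊double/2⌋ zero    = refl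
⌊double/2⌋ (suc m) = cong suc (⌊double/2⌋ m)

⌊suc-double/2⌋ : ∀ m → ⌊ suc (double m) /2⌋ ≡ m
⌊suc-double/2⌋ zero    = refl
⌊suc-double/2⌋ (suc m) = cong suc (⌊suc-double/2⌋ m)

data BinView : ℕ → Set where
  zero : BinView 0
  odd  : ∀ {m} → BinView m → BinView (suc (double m))
  even : ∀ {m} → BinView (suc m) → BinView (double (suc m))

binView-suc : BinView n → BinView (suc n)
binView-suc zero     = odd zero
binView-suc (odd v)  = even (binView-suc v)
binView-suc (even v) = odd v

binView : ∀ n → BinView n
binView zero    = zero
binView (suc n) = binView-suc (binView n)

binAux-fuel : ∀ f g n → n ≤ f → n ≤ g → binAux f n ≡ binAux g n
binAux-fuel zero    zero    zero _ _ = refl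
binAux-fuel zero    (suc g) zero _ _ = refl
binAux-fuel (suc f) zero    zero _ _ = refl
binAux-fuel (suc f) (suc g) zero _ _ = refl
binAux-fuel (suc f) (suc g) (suc k) (s≤s k≤f) (s≤s k≤g)
  with suc k % 2 | binAux-fuel f g ⌊ suc k /2⌋ (≤-trans half≤k k≤f) (≤-trans half≤k k≤g)
  where half≤k = ≤-pred (⌊n/2⌋<n k)
... | zero  | ih = cong (b0 ∷_) ih
... | suc _ | ih = cong (b1 ∷_) ih

bin-suc-even : ∀ k → suc k % 2 ≡ 0 → bin (suc k) ≡ b0 ∷ bin ⌊ suc k /2⌋
bin-suc-even k k+1-even rewrite k+1-even = cong (b0 ∷_) (binAux-fuel k _ _ (≤-pred (⌊n/2⌋<n k)) ≤-refl)

bin-suc-odd : ∀ k → suc k % 2 ≡ 1 → bin (suc k) ≡ b1 ∷ bin ⌊ suc k /2⌋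
bin-suc-odd k k+1-odd rewrite k+1-odd = cong (b1 ∷_) (binAux-fuel k _ _ (≤-pred (⌊n/2⌋<n k)) ≤-refl)

bin-double-suc : ∀ m → bin (double (suc m)) ≡ b0 ∷ bin (suc m)
bin-double-suc m = trans (bin-suc-even (suc (double m)) (double-%2 (suc m)))
                         (cong (λ x → b0 ∷ bin x) (⌊double/2⌋ (suc m)))

bin-suc-double : ∀ m → bin (suc (double m)) ≡ b1 ∷ bin m
bin-suc-double m = trans (bin-suc-odd (double m) (suc-double-%2 m))
                         (cong (λ x → b1 ∷ bin x) (⌊suc-double/2⌋ m))

PRED-1∷bin-suc : ∀ n → PRED (b1 ∷ bin (suc n)) ≡ b0 ∷ bin (suc n)
PRED-1∷bin-suc n with suc n % 2
... | zero  = refl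
... | suc _ = refl

PRED-bin-suc : BinView n → PRED (bin (suc n)) ≡ bin n
PRED-bin-suc zero = refl
PRED-bin-suc (odd {m} v) = begin
  PRED (bin (double (suc m)))  ≡⟨ cong PRED (bin-double-suc m) ⟩
  b1 ∷ PRED (bin (suc m))      ≡⟨ cong (b1 ∷_) (PRED-bin-suc v) ⟩
  b1 ∷ bin m                   ≡⟨ sym (bin-suc-double m) ⟩
  bin (suc (double m))         ∎
  where open ≡-Reasoning
PRED-bin-suc (even {m} _) = begin
  PRED (bin (suc (double (suc m))))  ≡⟨ cong PRED (bin-suc-double (suc m)) ⟩
  PRED (b1 ∷ bin (suc m))            ≡⟨ PRED-1∷bin-suc m ⟩
  b0 ∷ bin (suc m)                   ≡⟨ sym (bin-double-suc m) ⟩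
  bin (double (suc m))               ∎
  where open ≡-Reasoning

leadingZeros-bin≤⌊log₂⌋ : BinView n → leadingZeros (bin n) ≤ ⌊log₂ n ⌋
leadingZeros-bin≤⌊log₂⌋ zero = z≤n
leadingZeros-bin≤⌊log₂⌋ (odd {m} _) rewrite bin-suc-double m = z≤n
leadingZeros-bin≤⌊log₂⌋ (even {m} v) = begin
  leadingZeros (bin (double (suc m)))  ≡⟨ cong leadingZeros (bin-double-suc m) ⟩
  suc (leadingZeros (bin (suc m)))     ≤⟨ s≤s (leadingZeros-bin≤⌊log₂⌋ v) ⟩
  suc ⌊log₂ suc m ⌋                    ≡⟨ sym (⌊log₂[2*b]⌋≡1+⌊log₂b⌋ (suc m)) ⟩
  ⌊log₂ 2 * suc m ⌋                    ≡⟨ cong ⌊log₂_⌋ (sym (double≡2* (suc m))) ⟩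
  ⌊log₂ double (suc m) ⌋               ∎
  where open ≤-Reasoning

pred-cost≤ : ∀ n → 5 + predLoop-cost (bin n) ≤ 10 * ⌊log₂ n ⌋ + 17
pred-cost≤ n = begin
  5 + predLoop-cost (bin n)             ≤⟨ +-monoʳ-≤ 5 (predLoop-cost≤ (bin n)) ⟩
  5 + (10 * leadingZeros (bin n) + 12)  ≡⟨ +-comm 5 _ ⟩
  10 * leadingZeros (bin n) + 12 + 5    ≡⟨ +-assoc _ 12 5 ⟩
  10 * leadingZeros (bin n) + 17        ≤⟨ +-monoˡ-≤ 17 (*-monoʳ-≤ 10 (leadingZeros-bin≤⌊log₂⌋ (binView n))) ⟩
  10 * ⌊log₂ n ⌋ + 17                   ∎
  where open ≤-Reasoning

mainTheorem4 : Σ (Term 0) λ pred → ∃ λ c → ∃ λ d →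
    (∀ {s : ℕ} (k : Val s) (n : ℕ) → n ≥ 1 →
      (Σ ℕ λ m → (m ≤ c * ⌊log₂ n ⌋ + d)
        × (app (app (weaken pred) k) ⌈ bin n ⌉ ⟶[ m ] app (val k) ⌈ PRED (bin n) ⌉)))
    × (∀ (n : ℕ) → n ≥ 1 → PRED (bin n) ≡ bin (n ∸ 1))
mainTheorem4 =
  pred , 10 , 17 ,
  (λ k n _ → 5 + predLoop-cost (bin n) , pred-cost≤ n , pred-run k (bin n)) ,
  λ { (suc n) _ → PRED-bin-suc (binView n) }
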